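{- Let $k$ be an ordinal that is finite or equal to $\omega$. The restricted Yoneda functor $\mathbf{S}_k\to\widehat{\mathbf{P}_k}$, $A\mapsto \mathbf{S}_k(-,A)\colon \mathbf{P}_k^{\mathrm{op}}\to\mathbf{Set}$, is full and faithful.
   Context: A Kripke model is a set with a binary accessibility relation $R$, a subset $\mathscr{P}^A$ for each unary relation symbol $\mathscr{P}$ of a fixed vocabulary, and a distinguished element; homomorphisms preserve $R$, the unary relations and the distinguished element. A synchronization tree is a Kripke model $(C,c)$ such that every $x\in C$ is reached by a unique finite $R$-chain starting at $c$; the reflexive transitive closure of $R$ is then a tree order. $\mathbf{T}_k$ is the category of synchronization trees of height at most $k$ with homomorphisms; a pathwise embedding is a homomorphism that also reflects the unary relations; $\mathbf{S}_k$ is the wide subcategory of $\mathbf{T}_k$ with pathwise embeddings as morphisms. A path is a synchronization tree whose tree order is a finite chain. $\mathbf{P}_k$ is a small skeleton of the full subcategory of $\mathbf{S}_k$ on the paths (e.g. paths whose universes are initial segments of $\mathbb{N}$); it is a forest order. $\widehat{\mathbf{P}_k}=[\mathbf{P}_k^{\mathrm{op}},\mathbf{Set}]$. -}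

module Defs where

open import Level using (Level; 0ℓ) renaming (suc to lsuc)
open import Data.Nat using (ℕ; zero; suc; _≤_)
open import Data.Fin using (Fin; toℕ) renaming (zero to fzero)
open import Data.List using (List; []; _∷_)
open import Data.Unit using (⊤)
open import Data.Product using (Σ; Σ-syntax; _×_; _,_)
open import Relation.Binary.PropositionalEquality using (_≡_; refl; cong; trans)

data Height : Set where
  fin : ℕ → Height
  ω   : Height

_≤ₕ_ : ℕ → Height → Set
n ≤ₕ fin k = n ≤ k
n ≤ₕ ω     = ⊤

module _ (Sym : Set) where

  record Kripke : Set₁ where
    field
      Carrier : Set
      R       : Carrier → Carrier → Set
      Pred    : Sym → Carrier → Set
      root    : Carrier

  module _ (M : Kripke) where
    open Kripke M

    data Walk : Carrier → Carrier → Set where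
      []  : ∀ {a} → Walk a a
      _∷_ : ∀ {a b c} → R a b → Walk b c → Walk a c

    verts : ∀ {a b} → Walk a b → List Carrier
    verts {a} []      = a ∷ []
    verts {a} (r ∷ w) = a ∷ verts w

    len : ∀ {a b} → Walk a b → ℕ
    len []      = zero
    len (_ ∷ w) = suc (len w)

    IsSyncTree : Set
    IsSyncTree = ∀ x → Σ[ w ∈ Walk root x ] (∀ (w' : Walk root x) → verts w' ≡ verts w)

    HeightAtMost : Height → Set
    HeightAtMost k = ∀ x (w : Walk root x) → len w ≤ₕ k

  record PathwiseEmb (M N : Kripke) : Set where
    private
      module M = Kripke M
      module N = Kripke N
    field
      fun      : M.Carrier → N.Carrier
      pres-R   : ∀ {x y} → M.R x y → N.R (fun x) (fun y)
      pres-P   : ∀ s {x} → M.Pred s x → N.Pred s (fun x)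
      refl-P   : ∀ s {x} → N.Pred s (fun x) → M.Pred s x
      pres-root : fun M.root ≡ N.root
  open PathwiseEmb public

  _∘ₑ_ : ∀ {L M N} → PathwiseEmb M N → PathwiseEmb L M → PathwiseEmb L N
  fun (g ∘ₑ f) x = fun g (fun f x)
  pres-R (g ∘ₑ f) r = pres-R g (pres-R f r)
  pres-P (g ∘ₑ f) s p = pres-P g s (pres-P f s p)
  refl-P (g ∘ₑ f) s p = refl-P f s (refl-P g s p)
  pres-root (g ∘ₑ f) = trans (cong (fun g) (pres-root f)) (pres-root g)

  -- morphisms are functions, so they are equal when pointwise equal
  _≈ₑ_ : ∀ {M N} → PathwiseEmb M N → PathwiseEmb M N → Set
  f ≈ₑ g = ∀ x → fun f x ≡ fun g x

  module _ (k : Height) where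

    record Tree : Set₁ where
      field
        model  : Kripke
        isTree : IsSyncTree model
        height : HeightAtMost model k
    open Tree public

    record PathObj : Set₁ where
      field
        n     : ℕ
        n≤k   : n ≤ₕ k
        lab   : Fin (suc n) → Sym → Set
    open PathObj public

    pathModel : PathObj → Kripke
    pathModel P = record
      { Carrier = Fin (suc (n P))
      ; R       = λ i j → toℕ j ≡ suc (toℕ i)
      ; Pred    = λ s i → lab P i s
      ; root    = fzero
      }

    -- restricted Yoneda functor y A = S_k(-, A) : P_kᵒᵖ → Set (hom-setoids)
    -- natural transformations y A ⇒ y B
    record NatTrans (A B : Tree) : Set₁ where
      field
        η       : (P : PathObj) → PathwiseEmb (pathModel P) (model A)
                                → PathwiseEmb (pathModel P) (model B)
        η-resp  : ∀ P {h h'} → h ≈ₑ h' → η P h ≈ₑ η P h'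
        natural : ∀ P Q (g : PathwiseEmb (pathModel Q) (pathModel P))
                    (h : PathwiseEmb (pathModel P) (model A))
                  → η Q (h ∘ₑ g) ≈ₑ (η P h ∘ₑ g)
    open NatTrans public

    _≈ₙ_ : ∀ {A B} → NatTrans A B → NatTrans A B → Set₁
    α ≈ₙ β = ∀ P h → η α P h ≈ₑ η β P h

    yoneda : ∀ {A B : Tree} → PathwiseEmb (model A) (model B) → NatTrans A B
    η (yoneda f) P h = f ∘ₑ h
    η-resp (yoneda f) P e x = cong (fun f) (e x)
    natural (yoneda f) P Q g h x = refl

    Faithful : Set₁
    Faithful = ∀ {A B : Tree} (f g : PathwiseEmb (model A) (model B))
               → yoneda {A} {B} f ≈ₙ yoneda g → f ≈ₑ g

    Full : Set₁
    Full = ∀ {A B : Tree} (α : NatTrans A B)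
           → Σ[ f ∈ PathwiseEmb (model A) (model B) ] (yoneda {A} {B} f ≈ₙ α)

    YonedaFullyFaithful : Set₁
    YonedaFullyFaithful = Full × Faithful

{-# OPTIONS --safe #-}
-- Every element x of a synchronization tree A is the tip of its branch, the path embedding of the
-- unique root walk to x; so a morphism is determined by its composites with branches (faithfulness).
-- Given a natural transformation α, put f x := α(branch x)(tip). For any path embedding h and
-- point i, the prefix of h up to i is a root walk to h i, hence by uniqueness it is the branch of h i,
-- and that branch factors as h ∘ g with g an initial-segment inclusion; naturality along g then
-- gives f (h i) = α h i. Hence f ∘ h = α h, and f is a pathwise embedding since every α h is.
module Submission where

open import Defs
open import Function using (_∘_)
open import Data.Nat using (ℕ; zero; suc; _≤_; _<_; z≤n; s≤s; s≤s⁻¹)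
open import Data.Nat.Properties using (≤-trans; ≤-refl; n≤1+n; suc-injective; 0≢1+n)
open import Data.Fin using (Fin; toℕ; fromℕ) renaming (zero to fzero; suc to fsuc)
open import Data.Fin.Properties using (toℕ-injective; toℕ-fromℕ; toℕ<n)
open import Data.List using (length)
open import Data.List.Properties using (∷-injectiveˡ; ∷-injectiveʳ)
open import Data.Empty using (⊥-elim)
open import Data.Product using (Σ-syntax; _×_; _,_; proj₁; proj₂)
open import Relation.Binary.PropositionalEquality
open ≡-Reasoning

module Walks (Sym : Set) (M : Kripke Sym) where
  open Kripke M

  private
    W : Carrier → Carrier → Set
    W = Walk Sym M

    steps : ∀ {a b} → W a b → ℕ
    steps = len Sym M

  -- Indices beyond the end of the walk give its last vertex.
  vertex : ∀ {a b} → W a b → ℕ → Carrier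
  vertex {a} []      _       = a
  vertex {a} (_ ∷ _) zero    = a
  vertex     (_ ∷ w) (suc m) = vertex w m

  vertex-zero : ∀ {a b} (w : W a b) → vertex w 0 ≡ a
  vertex-zero []      = refl
  vertex-zero (_ ∷ _) = refl

  vertex-end : ∀ {a b} (w : W a b) → vertex w (steps w) ≡ b
  vertex-end []      = refl
  vertex-end (_ ∷ w) = vertex-end w

  vertex-R : ∀ {a b} (w : W a b) m → m < steps w → R (vertex w m) (vertex w (suc m))
  vertex-R (r ∷ w) zero    _         = subst (R _) (sym (vertex-zero w)) r
  vertex-R (_ ∷ w) (suc m) (s≤s m<n) = vertex-R w m m<n

  length-verts : ∀ {a b} (w : W a b) → length (verts Sym M w) ≡ suc (steps w)
  length-verts []      = refl
  length-verts (_ ∷ w) = cong suc (length-verts w)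

  verts≡⇒steps≡ : ∀ {a a′ b b′} (w : W a b) (w′ : W a′ b′) →
                  verts Sym M w ≡ verts Sym M w′ → steps w ≡ steps w′
  verts≡⇒steps≡ w w′ e =
    suc-injective (trans (sym (length-verts w)) (trans (cong length e) (length-verts w′)))

  verts≡⇒vertex≡ : ∀ {a a′ b b′} (w : W a b) (w′ : W a′ b′) →
                   verts Sym M w ≡ verts Sym M w′ → ∀ m → vertex w m ≡ vertex w′ m
  verts≡⇒vertex≡ []      []       e _       = ∷-injectiveˡ e
  verts≡⇒vertex≡ []      w′@(_ ∷ _) e _     = ⊥-elim (0≢1+n (verts≡⇒steps≡ [] w′ e))
  verts≡⇒vertex≡ w@(_ ∷ _) []     e _       = ⊥-elim (0≢1+n (sym (verts≡⇒steps≡ w [] e)))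
  verts≡⇒vertex≡ (_ ∷ _) (_ ∷ _)  e zero    = ∷-injectiveˡ e
  verts≡⇒vertex≡ (_ ∷ w) (_ ∷ w′) e (suc m) = verts≡⇒vertex≡ w w′ (∷-injectiveʳ e) m

  walkThrough : (n : ℕ) (φ : ℕ → Carrier) → (∀ m → m < n → R (φ m) (φ (suc m))) →
                ∀ {a b} → a ≡ φ 0 → φ n ≡ b → W a b
  walkThrough zero    φ p refl refl = []
  walkThrough (suc n) φ p refl e    =
    p 0 (s≤s z≤n) ∷ walkThrough n (φ ∘ suc) (λ m m<n → p (suc m) (s≤s m<n)) refl e

  steps-walkThrough : ∀ n φ p {a b} (s : a ≡ φ 0) (e : φ n ≡ b) →
                      steps (walkThrough n φ p s e) ≡ n
  steps-walkThrough zero    φ p refl refl = refl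
  steps-walkThrough (suc n) φ p refl e    = cong suc (steps-walkThrough n _ _ refl e)

  vertex-walkThrough : ∀ n φ p {a b} (s : a ≡ φ 0) (e : φ n ≡ b) →
                       ∀ m → m ≤ n → vertex (walkThrough n φ p s e) m ≡ φ m
  vertex-walkThrough zero    φ p refl refl zero    _         = refl
  vertex-walkThrough (suc n) φ p refl e    zero    _         = refl
  vertex-walkThrough (suc n) φ p refl e    (suc m) (s≤s m≤n) =
    vertex-walkThrough n _ _ refl e m m≤n

  _∷ʳ_ : ∀ {a b c} → W a b → R b c → W a c
  []      ∷ʳ r = r ∷ []
  (s ∷ w) ∷ʳ r = s ∷ (w ∷ʳ r)

  steps-∷ʳ : ∀ {a b c} (w : W a b) (r : R b c) → steps (w ∷ʳ r) ≡ suc (steps w)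
  steps-∷ʳ []      r = refl
  steps-∷ʳ (_ ∷ w) r = cong suc (steps-∷ʳ w r)

  vertex-∷ʳ : ∀ {a b c} (w : W a b) (r : R b c) m → m ≤ steps w → vertex (w ∷ʳ r) m ≡ vertex w m
  vertex-∷ʳ []      r zero    _         = refl
  vertex-∷ʳ (_ ∷ w) r zero    _         = refl
  vertex-∷ʳ (_ ∷ w) r (suc m) (s≤s m≤n) = vertex-∷ʳ w r m m≤n

  vertex-∷ʳ-end : ∀ {a b c} (w : W a b) (r : R b c) → vertex (w ∷ʳ r) (suc (steps w)) ≡ c
  vertex-∷ʳ-end []      r = refl
  vertex-∷ʳ-end (_ ∷ w) r = vertex-∷ʳ-end w r

-- Truncates to n when m > n.
clamp : (n m : ℕ) → Fin (suc n)
clamp n       zero    = fzero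
clamp zero    (suc m) = fzero
clamp (suc n) (suc m) = fsuc (clamp n m)

toℕ-clamp : ∀ n m → m ≤ n → toℕ (clamp n m) ≡ m
toℕ-clamp n       zero    _         = refl
toℕ-clamp (suc n) (suc m) (s≤s m≤n) = cong suc (toℕ-clamp n m m≤n)

toℕ≤ : ∀ {n} (i : Fin (suc n)) → toℕ i ≤ n
toℕ≤ i = s≤s⁻¹ (toℕ<n i)

clamp-toℕ : ∀ {n} (i : Fin (suc n)) → clamp n (toℕ i) ≡ i
clamp-toℕ i = toℕ-injective (toℕ-clamp _ (toℕ i) (toℕ≤ i))

module _ {Sym : Set} where

  factorThrough : ∀ {L N M} (h : PathwiseEmb Sym N M) (e : PathwiseEmb Sym L M)
                  (g : Kripke.Carrier L → Kripke.Carrier N) →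
                  (∀ {x y} → Kripke.R L x y → Kripke.R N (g x) (g y)) →
                  g (Kripke.root L) ≡ Kripke.root N →
                  (∀ x → fun h (g x) ≡ fun e x) → PathwiseEmb Sym L N
  fun       (factorThrough h e g _ _ _)  = g
  pres-R    (factorThrough h e g g-R _ _) = g-R
  pres-P    (factorThrough {M = M} h e g _ _ he) s {x} p =
    refl-P h s (subst (Kripke.Pred M s) (sym (he x)) (pres-P e s p))
  refl-P    (factorThrough {M = M} h e g _ _ he) s {x} p =
    refl-P e s (subst (Kripke.Pred M s) (he x) (pres-P h s p))
  pres-root (factorThrough h e g _ g-root _) = g-root

module PathsInto (Sym : Set) (k : Height) (M : Kripke Sym) where
  open Kripke M
  open Walks Sym M

  walkPath : ∀ {x} (w : Walk Sym M root x) → len Sym M w ≤ₕ k → PathObj Sym k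
  walkPath w ht = record { n = len Sym M w ; n≤k = ht ; lab = λ j s → Pred s (vertex w (toℕ j)) }

  walkEmb : ∀ {x} (w : Walk Sym M root x) (ht : len Sym M w ≤ₕ k) →
            PathwiseEmb Sym (pathModel Sym k (walkPath w ht)) M
  fun       (walkEmb w _) j = vertex w (toℕ j)
  pres-R    (walkEmb w _) {i} {j} e =
    subst (λ t → R (vertex w (toℕ i)) (vertex w t)) (sym e)
      (vertex-R w (toℕ i) (subst (_≤ len Sym M w) e (toℕ≤ j)))
  pres-P    (walkEmb w _) s p = p
  refl-P    (walkEmb w _) s p = p
  pres-root (walkEmb w _) = vertex-zero w

  module Prefix {P : PathObj Sym k} (h : PathwiseEmb Sym (pathModel Sym k P) M) (i : Fin (suc (n P))) where

    private
      φ : ℕ → Carrier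
      φ m = fun h (clamp (n P) m)

      φ-R : ∀ m → m < toℕ i → R (φ m) (φ (suc m))
      φ-R m m<i = pres-R h (begin
        toℕ (clamp (n P) (suc m)) ≡⟨ toℕ-clamp (n P) (suc m) 1+m≤n ⟩
        suc m                     ≡⟨ cong suc (toℕ-clamp (n P) m (≤-trans (n≤1+n m) 1+m≤n)) ⟨
        suc (toℕ (clamp (n P) m)) ∎)
        where 1+m≤n = ≤-trans m<i (toℕ≤ i)

    prefix : Walk Sym M root (fun h i)
    prefix = walkThrough (toℕ i) φ φ-R (sym (pres-root h)) (cong (fun h) (clamp-toℕ i))

    steps-prefix : len Sym M prefix ≡ toℕ i
    steps-prefix = steps-walkThrough (toℕ i) φ φ-R _ _

    vertex-prefix : ∀ m → m ≤ toℕ i → vertex prefix m ≡ fun h (clamp (n P) m)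
    vertex-prefix = vertex-walkThrough (toℕ i) φ φ-R _ _

module Branches (Sym : Set) (k : Height) (A : Tree Sym k) where
  MA : Kripke Sym
  MA = model A
  open Kripke MA
  open Walks Sym MA
  open PathsInto Sym k MA public

  rootWalk : ∀ x → Walk Sym MA root x
  rootWalk x = proj₁ (isTree A x)

  rootWalk-unique : ∀ {x} (w : Walk Sym MA root x) → verts Sym MA w ≡ verts Sym MA (rootWalk x)
  rootWalk-unique {x} = proj₂ (isTree A x)

  Branch : Carrier → PathObj Sym k
  Branch x = walkPath (rootWalk x) (height A x (rootWalk x))

  branch : ∀ x → PathwiseEmb Sym (pathModel Sym k (Branch x)) MA
  branch x = walkEmb (rootWalk x) (height A x (rootWalk x))

  tip : ∀ x → Fin (suc (n (Branch x)))
  tip x = fromℕ (len Sym MA (rootWalk x))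

  branch-tip : ∀ x → fun (branch x) (tip x) ≡ x
  branch-tip x = trans (cong (vertex (rootWalk x)) (toℕ-fromℕ _)) (vertex-end (rootWalk x))

  branch-factors : ∀ {P} (h : PathwiseEmb Sym (pathModel Sym k P) MA) (i : Fin (suc (n P))) →
    Σ[ g ∈ PathwiseEmb Sym (pathModel Sym k (Branch (fun h i))) (pathModel Sym k P) ]
      ((∀ j → fun h (fun g j) ≡ fun (branch (fun h i)) j) × fun g (tip (fun h i)) ≡ i)
  branch-factors {P} h i = g , commutes , g-tip
    where
      open Prefix {P} h i

      x : Carrier
      x = fun h i

      same : verts Sym MA prefix ≡ verts Sym MA (rootWalk x)
      same = rootWalk-unique prefix

      steps≡ : len Sym MA (rootWalk x) ≡ toℕ i
      steps≡ = trans (sym (verts≡⇒steps≡ prefix (rootWalk x) same)) steps-prefix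

      ≤i : ∀ (j : Fin (suc (n (Branch x)))) → toℕ j ≤ toℕ i
      ≤i j = subst (toℕ j ≤_) steps≡ (toℕ≤ j)

      toℕ-inclusion : ∀ j → toℕ (clamp (n P) (toℕ j)) ≡ toℕ j
      toℕ-inclusion j = toℕ-clamp (n P) (toℕ j) (≤-trans (≤i j) (toℕ≤ i))

      commutes : ∀ j → fun h (clamp (n P) (toℕ j)) ≡ fun (branch x) j
      commutes j = trans (sym (vertex-prefix (toℕ j) (≤i j)))
                         (verts≡⇒vertex≡ prefix (rootWalk x) same (toℕ j))

      g : PathwiseEmb Sym (pathModel Sym k (Branch x)) (pathModel Sym k P)
      g = factorThrough h (branch x) (clamp (n P) ∘ toℕ)
            (λ {a} {b} e → trans (toℕ-inclusion b) (trans e (cong suc (sym (toℕ-inclusion a)))))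
            refl commutes

      g-tip : clamp (n P) (toℕ (tip x)) ≡ i
      g-tip = toℕ-injective (trans (toℕ-inclusion (tip x)) (trans (toℕ-fromℕ _) steps≡))

faithful : (Sym : Set) (k : Height) → Faithful Sym k
faithful Sym k {A} f g fy≈gy x = begin
  fun f x                       ≡⟨ cong (fun f) (branch-tip x) ⟨
  fun f (fun (branch x) (tip x)) ≡⟨ fy≈gy (Branch x) (branch x) (tip x) ⟩
  fun g (fun (branch x) (tip x)) ≡⟨ cong (fun g) (branch-tip x) ⟩
  fun g x                       ∎
  where open Branches Sym k A

module Full (Sym : Set) (k : Height) {A B : Tree Sym k} (α : NatTrans Sym k A B) where
  open Branches Sym k A
  open Kripke MA
  open Walks Sym MA
  module B = Kripke (model B)

  F : Carrier → B.Carrier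
  F x = fun (η α (Branch x) (branch x)) (tip x)

  F-natural : ∀ P (h : PathwiseEmb Sym (pathModel Sym k P) MA) i → F (fun h i) ≡ fun (η α P h) i
  F-natural P h i with branch-factors {P} h i
  ... | g , commutes , g-tip = begin
    fun (η α (Branch x) (branch x)) (tip x)             ≡⟨ η-resp α (Branch x) commutes (tip x) ⟨
    fun (η α (Branch x) (_∘ₑ_ Sym h g)) (tip x)          ≡⟨ natural α P (Branch x) g h (tip x) ⟩
    fun (η α P h) (fun g (tip x))                       ≡⟨ cong (fun (η α P h)) g-tip ⟩
    fun (η α P h) i                                     ∎
    where
      x : Carrier
      x = fun h i

  F-R : ∀ {x y} → R x y → B.R (F x) (F y)
  F-R {x} {y} r = subst₂ B.R (sym Fx) (sym Fy) (pres-R (η α P h) {i₁} {i₂} i₂≡1+i₁)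
    where
      w : Walk Sym MA root y
      w = rootWalk x ∷ʳ r
      P : PathObj Sym k
      P = walkPath w (height A y w)
      h : PathwiseEmb Sym (pathModel Sym k P) MA
      h = walkEmb w (height A y w)
      ℓ : ℕ
      ℓ = len Sym MA (rootWalk x)
      ℓ≤ : ℓ ≤ len Sym MA w
      ℓ≤ = subst (ℓ ≤_) (sym (steps-∷ʳ (rootWalk x) r)) (n≤1+n ℓ)
      1+ℓ≤ : suc ℓ ≤ len Sym MA w
      1+ℓ≤ = subst (suc ℓ ≤_) (sym (steps-∷ʳ (rootWalk x) r)) ≤-refl
      i₁ i₂ : Fin (suc (len Sym MA w))
      i₁ = clamp (len Sym MA w) ℓ
      i₂ = clamp (len Sym MA w) (suc ℓ)
      i₂≡1+i₁ : toℕ i₂ ≡ suc (toℕ i₁)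
      i₂≡1+i₁ = trans (toℕ-clamp _ _ 1+ℓ≤) (cong suc (sym (toℕ-clamp _ _ ℓ≤)))
      hi₁≡x : fun h i₁ ≡ x
      hi₁≡x = trans (cong (vertex w) (toℕ-clamp _ _ ℓ≤))
                (trans (vertex-∷ʳ (rootWalk x) r ℓ ≤-refl) (vertex-end (rootWalk x)))
      hi₂≡y : fun h i₂ ≡ y
      hi₂≡y = trans (cong (vertex w) (toℕ-clamp _ _ 1+ℓ≤)) (vertex-∷ʳ-end (rootWalk x) r)
      Fx : F x ≡ fun (η α P h) i₁
      Fx = trans (cong F (sym hi₁≡x)) (F-natural P h i₁)
      Fy : F y ≡ fun (η α P h) i₂
      Fy = trans (cong F (sym hi₂≡y)) (F-natural P h i₂)

  f : PathwiseEmb Sym MA (model B)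
  fun       f = F
  pres-R    f = F-R
  pres-P    f s {x} p = pres-P (η α (Branch x) (branch x)) s (subst (Pred s) (sym (branch-tip x)) p)
  refl-P    f s {x} q = subst (Pred s) (branch-tip x) (refl-P (η α (Branch x) (branch x)) s q)
  pres-root f = trans (F-natural P h fzero) (pres-root (η α P h))
    where
      P : PathObj Sym k
      P = walkPath [] (height A root [])
      h : PathwiseEmb Sym (pathModel Sym k P) MA
      h = walkEmb [] (height A root [])

full : (Sym : Set) (k : Height) → Full Sym k
full Sym k {A} {B} α = f , F-natural
  where open Full Sym k {A} {B} α

proposition3p7 : (Sym : Set) (k : Height) → YonedaFullyFaithful Sym k
proposition3p7 Sym k = full Sym k , λ {A} {B} → faithful Sym k {A} {B}
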